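{- For every integer $k\ge 2$, $$\sum_{n\ge1}x^n\sum_{w\in\mathcal F_{n,k}}\mathrm{area}(P(w))=\frac{3x-2kx^k-2(2-k)x^{k+1}+x^{2k+1}}{(1-2x+x^{k+1})^2}$$ and $$\sum_{n\ge1}x^n\sum_{w\in\mathcal F_{n,k}}\mathrm{sper}(P(w))=\frac{5x-5x^2-(2+k)x^k-(1-k)x^{k+1}+4x^{k+2}-x^{2k+2}}{(1-2x+x^{k+1})^2}.$$
   Context: For integers $k\ge 2$ and $n\ge 1$, $\mathcal F_{n,k}$ denotes the set of binary words $w=w_1\cdots w_n\in\{0,1\}^n$ that do not contain $k$ consecutive $1$'s. To $w\in\mathcal F_{n,k}$ one associates the bargraph polyomino $P(w)$: the union of the unit squares $[i-1,i]\times[j-1,j]$ for $1\le i\le n$, $1\le j\le w_i+1$ (the $i$-th column has $w_i+1$ cells). $\mathrm{area}(P)$ is the number of cells of $P$ and $\mathrm{sper}(P)$ is half of the perimeter of $P$. -}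

module Defs where

open import Data.Bool using (Bool; true; false; _∧_; _∨_; not; if_then_else_)
open import Data.Nat using (ℕ; zero; suc; _+_; _*_; _∸_; _/_)
open import Data.List using (List; []; _∷_; map; _++_; filter; length)
open import Data.Nat.ListAction using (sum)
open import Data.Integer using (ℤ; +_; -_) renaming (_+_ to _+ℤ_; _*_ to _*ℤ_)
open import Relation.Nullary.Decidable using (yes; no)
import Data.Nat
open import Relation.Binary.PropositionalEquality using (_≡_)
open import Data.Bool.Properties using () renaming (_≟_ to _≟𝔹_)

-- Binary words are lists of booleans (true = 1, false = 0).
Word : Set
Word = List Bool

words : ℕ → List Word
words zero    = [] ∷ []
words (suc n) = map (false ∷_) (words n) ++ map (true ∷_) (words n)

startsWithOnes : ℕ → Word → Bool
startsWithOnes zero    w        = true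
startsWithOnes (suc k) []       = false
startsWithOnes (suc k) (b ∷ w)  = b ∧ startsWithOnes k w

containsOnes : ℕ → Word → Bool
containsOnes k []       = startsWithOnes k []
containsOnes k (b ∷ w)  = startsWithOnes k (b ∷ w) ∨ containsOnes k w

F : ℕ → ℕ → List Word
F n k = filter (λ w → not (containsOnes k w) ≟𝔹 true) (words n)

-- letter value and column height of the bargraph P(w): column i has w_i + 1 cells
bit : Bool → ℕ
bit false = 0
bit true  = 1

heights : Word → List ℕ
heights w = map (λ b → bit b + 1) w

area : Word → ℕ
area w = sum (heights w)

dist : ℕ → ℕ → ℕ
dist a b = (a ∸ b) + (b ∸ a)

jumps : List ℕ → ℕ
jumps []            = 0
jumps (h ∷ [])      = 0
jumps (h ∷ h' ∷ hs) = dist h h' + jumps (h' ∷ hs)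

firstH : List ℕ → ℕ
firstH []      = 0
firstH (h ∷ _) = h

lastH : List ℕ → ℕ
lastH []           = 0
lastH (h ∷ [])     = h
lastH (h ∷ h' ∷ hs) = lastH (h' ∷ hs)

-- Perimeter of a bargraph with column heights h_1..h_n (unit boundary edges):
-- 2n horizontal edges (top and bottom of each column),
-- h_1 + h_n vertical edges on the left/right sides, and
-- |h_i - h_{i+1}| vertical edges between consecutive columns.
perimeter : Word → ℕ
perimeter w = 2 * length w + firstH (heights w) + lastH (heights w) + jumps (heights w)

-- semiperimeter = half of the perimeter (the perimeter is always even)
sper : Word → ℕ
sper w = perimeter w / 2

Series : Set
Series = ℕ → ℤ

sumTo : ℕ → (ℕ → ℤ) → ℤ
sumTo zero    f = f 0
sumTo (suc n) f = sumTo n f +ℤ f (suc n)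

_⊛_ : Series → Series → Series
(f ⊛ g) n = sumTo n (λ i → f i *ℤ g (n ∸ i))

_⊕_ : Series → Series → Series
(f ⊕ g) n = f n +ℤ g n

mono : ℤ → ℕ → Series
mono c e n with e Data.Nat.≟ n
... | yes _ = c
... | no  _ = + 0

gfStat : (Word → ℕ) → ℕ → Series
gfStat stat k zero    = + 0
gfStat stat k (suc n) = + sum (map stat (F (suc n) k))

areaGF : ℕ → Series
areaGF = gfStat area

sperGF : ℕ → Series
sperGF = gfStat sper

base : ℕ → Series
base k = mono (+ 1) 0 ⊕ (mono (- + 2) 1 ⊕ mono (+ 1) (k + 1))

denom : ℕ → Series
denom k = base k ⊛ base k

-- 3x - 2k x^k - 2(2-k) x^{k+1} + x^{2k+1}
-- (note -2(2-k) = 2k - 4)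
numArea : ℕ → Series
numArea k = mono (+ 3) 1
          ⊕ (mono (- (+ (2 * k))) k
          ⊕ (mono ((+ (2 * k)) +ℤ (- (+ 4))) (k + 1)
          ⊕ mono (+ 1) (2 * k + 1)))

-- 5x - 5x^2 - (2+k) x^k - (1-k) x^{k+1} + 4 x^{k+2} - x^{2k+2}
-- (note -(1-k) = k - 1)
numSper : ℕ → Series
numSper k = mono (+ 5) 1
          ⊕ (mono (- (+ 5)) 2
          ⊕ (mono (- (+ (2 + k))) k
          ⊕ (mono ((+ k) +ℤ (- (+ 1))) (k + 1)
          ⊕ (mono (+ 4) (k + 2)
          ⊕ mono (- (+ 1)) (2 * k + 2)))))

-- Let C n, A n and S n be the number of words in F_{n,k} and the sums over them of the area and of
-- n + 1 + (number of blocks of 1's), which is the semiperimeter of every nonempty bargraph. A word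
-- of length n + 1 is 0u or 1u with u in F_{n,k}, except that 1u is forbidden exactly when u is
-- 1^{k-1} or 1^{k-1}0v with v in F_{n-k,k}. Each statistic changes in a simple way under these
-- prefixes, so with P = 1 - 2x + x^{k+1} one gets P C = 1 - x^k, P A = q C + r and P S = q' C + r'
-- for explicit polynomials q, r, q', r'. Multiplying by P once more eliminates C:
-- P² A = q (1 - x^k) + P r, and likewise for S; expanding gives the two numerators.
-- The argument works for every k ≥ 1.
module Submission where

open import Defs
open import Data.Nat using (ℕ; _≥_)
open import Data.Product using (_×_)
open import Relation.Binary.PropositionalEquality using (_≡_)

open import Data.Nat as ℕ using (zero; suc)
import Data.Nat.Properties as ℕ
open import Data.Nat.DivMod using (m*n/n≡m)
open import Data.Nat.ListAction using (sum)
open import Data.Nat.Tactic.RingSolver using () renaming (solve-∀ to ℕ-solve-∀)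
open import Data.Integer using (ℤ; +_; -_; _+_; _*_; _-_)
import Data.Integer.Properties as ℤ
open import Data.Integer.Tactic.RingSolver using (solve-∀)
open import Data.Bool using (Bool; true; false; not; _∨_)
open import Data.Bool.Properties using () renaming (_≟_ to _≟𝔹_)
open import Data.List using (List; []; _∷_; map; _++_; replicate; filter; length)
open import Data.List.Properties using (++-identityʳ; length-++; length-replicate)
open import Data.Product using (_,_)
open import Function using (_∘_)
open import Relation.Binary.PropositionalEquality
  using (refl; sym; trans; cong; cong₂; module ≡-Reasoning)
open import Relation.Nullary using (Dec; yes; no; ¬_; contradiction)
open import Algebra.Properties.CommutativeSemigroup ℤ.+-commutativeSemigroup
  using (interchange)

open ≡-Reasoning

mono-diag : ∀ c e → mono c e e ≡ c
mono-diag c e with e ℕ.≟ e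
... | yes _ = refl
... | no e≢e = contradiction refl e≢e

mono-off : ∀ c {e n} → ¬ e ≡ n → mono c e n ≡ + 0
mono-off c {e} {n} e≢n with e ℕ.≟ n
... | yes e≡n = contradiction e≡n e≢n
... | no _ = refl

mono-suc : ∀ c e n → mono c (suc e) (suc n) ≡ mono c e n
mono-suc c e n = by-cases (e ℕ.≟ n)
  where
  by-cases : Dec (e ≡ n) → mono c (suc e) (suc n) ≡ mono c e n
  by-cases (yes refl) = trans (mono-diag c (suc e)) (sym (mono-diag c e))
  by-cases (no e≢n)   = trans (mono-off c (e≢n ∘ ℕ.suc-injective)) (sym (mono-off c e≢n))

mono-scale : ∀ c e n → mono c e n ≡ c * mono (+ 1) e n
mono-scale c e n with e ℕ.≟ n
... | yes _ = sym (ℤ.*-identityʳ c)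
... | no _  = sym (ℤ.*-zeroʳ c)

shift : ℕ → Series → Series
shift zero    g n       = g n
shift (suc e) g zero    = + 0
shift (suc e) g (suc n) = shift e g n

shift-cong : ∀ e {f g : Series} → (∀ i → f i ≡ g i) → ∀ n → shift e f n ≡ shift e g n
shift-cong zero    f≡g n       = f≡g n
shift-cong (suc e) f≡g zero    = refl
shift-cong (suc e) f≡g (suc n) = shift-cong e f≡g n

shift-⊕ : ∀ e (f g : Series) n → shift e (f ⊕ g) n ≡ shift e f n + shift e g n
shift-⊕ zero    f g n       = refl
shift-⊕ (suc e) f g zero    = refl
shift-⊕ (suc e) f g (suc n) = shift-⊕ e f g n

shift-* : ∀ e c (g : Series) n → shift e (λ i → c * g i) n ≡ c * shift e g n
shift-* zero    c g n       = refl
shift-* (suc e) c g zero    = sym (ℤ.*-zeroʳ c)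
shift-* (suc e) c g (suc n) = shift-* e c g n

shift-shift : ∀ e f (g : Series) n → shift e (shift f g) n ≡ shift (e ℕ.+ f) g n
shift-shift zero    f g n       = refl
shift-shift (suc e) f g zero    = refl
shift-shift (suc e) f g (suc n) = shift-shift e f g n

shift-comm : ∀ e f (g : Series) n → shift e (shift f g) n ≡ shift f (shift e g) n
shift-comm e f g n = begin
  shift e (shift f g) n  ≡⟨ shift-shift e f g n ⟩
  shift (e ℕ.+ f) g n    ≡⟨ cong (λ d → shift d g n) (ℕ.+-comm e f) ⟩
  shift (f ℕ.+ e) g n    ≡⟨ shift-shift f e g n ⟨
  shift f (shift e g) n  ∎

shift-mono : ∀ e c f n → shift e (mono c f) n ≡ mono c (e ℕ.+ f) n
shift-mono zero    c f n       = refl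
shift-mono (suc e) c f zero    = refl
shift-mono (suc e) c f (suc n) = trans (shift-mono e c f n) (sym (mono-suc c (e ℕ.+ f) n))

sumTo-cong : ∀ n {f g : ℕ → ℤ} → (∀ i → f i ≡ g i) → sumTo n f ≡ sumTo n g
sumTo-cong zero    f≡g = f≡g 0
sumTo-cong (suc n) f≡g = cong₂ _+_ (sumTo-cong n f≡g) (f≡g (suc n))

sumTo-zero : ∀ n → sumTo n (λ _ → + 0) ≡ + 0
sumTo-zero zero    = refl
sumTo-zero (suc n) = cong (_+ + 0) (sumTo-zero n)

sumTo-+ : ∀ n (f g : ℕ → ℤ) → sumTo n (λ i → f i + g i) ≡ sumTo n f + sumTo n g
sumTo-+ zero    f g = refl
sumTo-+ (suc n) f g = trans (cong (_+ (f (suc n) + g (suc n))) (sumTo-+ n f g))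
                            (interchange (sumTo n f) (sumTo n g) (f (suc n)) (g (suc n)))

sumTo-uncons : ∀ n (f : ℕ → ℤ) → sumTo (suc n) f ≡ f 0 + sumTo n (λ i → f (suc i))
sumTo-uncons zero    f = refl
sumTo-uncons (suc n) f = trans (cong (_+ f (suc (suc n))) (sumTo-uncons n f))
                               (ℤ.+-assoc (f 0) _ _)

⊛-cong : ∀ {f f′ g g′ : Series} → (∀ i → f i ≡ f′ i) → (∀ i → g i ≡ g′ i) → ∀ n → (f ⊛ g) n ≡ (f′ ⊛ g′) n
⊛-cong f≡f′ g≡g′ n = sumTo-cong n (λ i → cong₂ _*_ (f≡f′ i) (g≡g′ (n ℕ.∸ i)))

⊛-distribʳ-⊕ : ∀ (f g h : Series) n → ((f ⊕ g) ⊛ h) n ≡ (f ⊛ h) n + (g ⊛ h) n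
⊛-distribʳ-⊕ f g h n =
  trans (sumTo-cong n (λ i → ℤ.*-distribʳ-+ (h (n ℕ.∸ i)) (f i) (g i))) (sumTo-+ n _ _)


mono-⊛ : ∀ c e (g : Series) n → (mono c e ⊛ g) n ≡ c * shift e g n
mono-⊛ c zero    g zero    = refl
mono-⊛ c zero    g (suc n) = begin
  sumTo (suc n) (λ i → mono c 0 i * g (suc n ℕ.∸ i))
    ≡⟨ sumTo-uncons n _ ⟩
  c * g (suc n) + sumTo n (λ i → + 0 * g (n ℕ.∸ i))
    ≡⟨ cong (_+_ (c * g (suc n))) (trans (sumTo-cong n (λ i → ℤ.*-zeroˡ (g (n ℕ.∸ i)))) (sumTo-zero n)) ⟩
  c * g (suc n) + + 0
    ≡⟨ ℤ.+-identityʳ _ ⟩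
  c * g (suc n) ∎
mono-⊛ c (suc e) g zero    = sym (ℤ.*-zeroʳ c)
mono-⊛ c (suc e) g (suc n) = begin
  sumTo (suc n) (λ i → mono c (suc e) i * g (suc n ℕ.∸ i))
    ≡⟨ sumTo-uncons n _ ⟩
  + 0 + sumTo n (λ i → mono c (suc e) (suc i) * g (n ℕ.∸ i))
    ≡⟨ ℤ.+-identityˡ _ ⟩
  sumTo n (λ i → mono c (suc e) (suc i) * g (n ℕ.∸ i))
    ≡⟨ sumTo-cong n (λ i → cong (_* g (n ℕ.∸ i)) (mono-suc c e i)) ⟩
  (mono c e ⊛ g) n
    ≡⟨ mono-⊛ c e g n ⟩
  c * shift e g n ∎

shift-zero : ∀ e n → shift e (λ _ → + 0) n ≡ + 0
shift-zero zero    n       = refl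
shift-zero (suc e) zero    = refl
shift-zero (suc e) (suc n) = shift-zero e n

Poly : Set
Poly = List (ℤ × ℕ)

⟦_⟧ : Poly → Series
⟦ [] ⟧          n = + 0
⟦ (c , e) ∷ p ⟧ n = mono c e n + ⟦ p ⟧ n

_⊙_ : Poly → Series → Series
([]            ⊙ g) n = + 0
(((c , e) ∷ p) ⊙ g) n = c * shift e g n + (p ⊙ g) n

scale : ℤ → ℕ → ℤ × ℕ → ℤ × ℕ
scale c e (d , f) = (c * d , e ℕ.+ f)

_⊗_ : Poly → Poly → Poly
[]            ⊗ q = []
((c , e) ∷ p) ⊗ q = map (scale c e) q ++ (p ⊗ q)

⟦⟧-⊛ : ∀ p (g : Series) n → (⟦ p ⟧ ⊛ g) n ≡ (p ⊙ g) n
⟦⟧-⊛ []            g n = trans (sumTo-cong n (λ i → ℤ.*-zeroˡ (g (n ℕ.∸ i)))) (sumTo-zero n)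
⟦⟧-⊛ ((c , e) ∷ p) g n =
  trans (⊛-distribʳ-⊕ (mono c e) ⟦ p ⟧ g n) (cong₂ _+_ (mono-⊛ c e g n) (⟦⟧-⊛ p g n))

⊙-cong : ∀ p {f g : Series} → (∀ i → f i ≡ g i) → ∀ n → (p ⊙ f) n ≡ (p ⊙ g) n
⊙-cong []            f≡g n = refl
⊙-cong ((c , e) ∷ p) f≡g n = cong₂ _+_ (cong (c *_) (shift-cong e f≡g n)) (⊙-cong p f≡g n)

⊙-⊕ : ∀ p (f g : Series) n → (p ⊙ (f ⊕ g)) n ≡ (p ⊙ f) n + (p ⊙ g) n
⊙-⊕ []            f g n = refl
⊙-⊕ ((c , e) ∷ p) f g n = begin
  c * shift e (f ⊕ g) n + (p ⊙ (f ⊕ g)) n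
    ≡⟨ cong₂ _+_ (trans (cong (c *_) (shift-⊕ e f g n)) (ℤ.*-distribˡ-+ c _ _)) (⊙-⊕ p f g n) ⟩
  (c * shift e f n + c * shift e g n) + ((p ⊙ f) n + (p ⊙ g) n)
    ≡⟨ interchange (c * shift e f n) (c * shift e g n) ((p ⊙ f) n) ((p ⊙ g) n) ⟩
  (c * shift e f n + (p ⊙ f) n) + (c * shift e g n + (p ⊙ g) n) ∎

⊙-* : ∀ p c (g : Series) n → (p ⊙ (λ i → c * g i)) n ≡ c * (p ⊙ g) n
⊙-* []            c g n = sym (ℤ.*-zeroʳ c)
⊙-* ((d , e) ∷ p) c g n =
  trans (cong₂ _+_ (trans (cong (d *_) (shift-* e c g n)) (commute d c (shift e g n))) (⊙-* p c g n))
        (sym (ℤ.*-distribˡ-+ c _ _))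
  where commute : ∀ a b x → a * (b * x) ≡ b * (a * x)
        commute = solve-∀

⊙-++ : ∀ p q (g : Series) n → ((p ++ q) ⊙ g) n ≡ (p ⊙ g) n + (q ⊙ g) n
⊙-++ []            q g n = sym (ℤ.+-identityˡ _)
⊙-++ ((c , e) ∷ p) q g n =
  trans (cong (_+_ (c * shift e g n)) (⊙-++ p q g n)) (sym (ℤ.+-assoc (c * shift e g n) ((p ⊙ g) n) ((q ⊙ g) n)))

shift-⊙ : ∀ e p (g : Series) n → shift e (p ⊙ g) n ≡ (p ⊙ shift e g) n
shift-⊙ e []            g n = shift-zero e n
shift-⊙ e ((c , f) ∷ p) g n = begin
  shift e (((c , f) ∷ p) ⊙ g) n
    ≡⟨ shift-⊕ e (λ i → c * shift f g i) (p ⊙ g) n ⟩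
  shift e (λ i → c * shift f g i) n + shift e (p ⊙ g) n
    ≡⟨ cong₂ _+_ (trans (shift-* e c (shift f g) n) (cong (c *_) (shift-comm e f g n))) (shift-⊙ e p g n) ⟩
  c * shift f (shift e g) n + (p ⊙ shift e g) n ∎

scale-⊙ : ∀ c e q (g : Series) n → (map (scale c e) q ⊙ g) n ≡ c * shift e (q ⊙ g) n
scale-⊙ c e []            g n = sym (trans (cong (c *_) (shift-zero e n)) (ℤ.*-zeroʳ c))
scale-⊙ c e ((d , f) ∷ q) g n = begin
  c * d * shift (e ℕ.+ f) g n + (map (scale c e) q ⊙ g) n
    ≡⟨ cong₂ _+_ (trans (ℤ.*-assoc c d _) (sym (cong (λ x → c * (d * x)) (shift-shift e f g n))))
                 (scale-⊙ c e q g n) ⟩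
  c * (d * shift e (shift f g) n) + c * shift e (q ⊙ g) n
    ≡⟨ ℤ.*-distribˡ-+ c _ _ ⟨
  c * (d * shift e (shift f g) n + shift e (q ⊙ g) n)
    ≡⟨ cong (λ x → c * (x + shift e (q ⊙ g) n)) (shift-* e d (shift f g) n) ⟨
  c * (shift e (λ i → d * shift f g i) n + shift e (q ⊙ g) n)
    ≡⟨ cong (c *_) (shift-⊕ e (λ i → d * shift f g i) (q ⊙ g) n) ⟨
  c * shift e (((d , f) ∷ q) ⊙ g) n ∎

⊗-⊙ : ∀ p q (g : Series) n → ((p ⊗ q) ⊙ g) n ≡ (p ⊙ (q ⊙ g)) n
⊗-⊙ []            q g n = refl
⊗-⊙ ((c , e) ∷ p) q g n =
  trans (⊙-++ (map (scale c e) q) (p ⊗ q) g n) (cong₂ _+_ (scale-⊙ c e q g n) (⊗-⊙ p q g n))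

⊙-zero : ∀ p n → (p ⊙ (λ _ → + 0)) n ≡ + 0
⊙-zero []            n = refl
⊙-zero ((c , e) ∷ p) n = cong₂ _+_ (trans (cong (c *_) (shift-zero e n)) (ℤ.*-zeroʳ c)) (⊙-zero p n)

⊙-comm : ∀ p q (g : Series) n → (p ⊙ (q ⊙ g)) n ≡ (q ⊙ (p ⊙ g)) n
⊙-comm []            q g n = sym (⊙-zero q n)
⊙-comm ((c , e) ∷ p) q g n = begin
  c * shift e (q ⊙ g) n + (p ⊙ (q ⊙ g)) n
    ≡⟨ cong₂ _+_ (cong (c *_) (shift-⊙ e q g n)) (⊙-comm p q g n) ⟩
  c * (q ⊙ shift e g) n + (q ⊙ (p ⊙ g)) n
    ≡⟨ cong (_+ (q ⊙ (p ⊙ g)) n) (⊙-* q c (shift e g) n) ⟨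
  (q ⊙ (λ i → c * shift e g i)) n + (q ⊙ (p ⊙ g)) n
    ≡⟨ ⊙-⊕ q (λ i → c * shift e g i) (p ⊙ g) n ⟨
  (q ⊙ (((c , e) ∷ p) ⊙ g)) n ∎

⟦⟧-as-⊙ : ∀ p n → ⟦ p ⟧ n ≡ (p ⊙ mono (+ 1) 0) n
⟦⟧-as-⊙ []            n = refl
⟦⟧-as-⊙ ((c , e) ∷ p) n = cong₂ _+_ unit (⟦⟧-as-⊙ p n)
  where unit : mono c e n ≡ c * shift e (mono (+ 1) 0) n
        unit = begin
          mono c e n                   ≡⟨ mono-scale c e n ⟩
          c * mono (+ 1) e n           ≡⟨ cong (λ d → c * mono (+ 1) d n) (ℕ.+-identityʳ e) ⟨
          c * mono (+ 1) (e ℕ.+ 0) n   ≡⟨ cong (c *_) (shift-mono e (+ 1) 0 n) ⟨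
          c * shift e (mono (+ 1) 0) n ∎

⊙-⟦⟧ : ∀ p q n → (p ⊙ ⟦ q ⟧) n ≡ ⟦ p ⊗ q ⟧ n
⊙-⟦⟧ p q n = begin
  (p ⊙ ⟦ q ⟧) n                   ≡⟨ ⊙-cong p (⟦⟧-as-⊙ q) n ⟩
  (p ⊙ (q ⊙ mono (+ 1) 0)) n      ≡⟨ ⊗-⊙ p q (mono (+ 1) 0) n ⟨
  ((p ⊗ q) ⊙ mono (+ 1) 0) n      ≡⟨ ⟦⟧-as-⊙ (p ⊗ q) n ⟨
  ⟦ p ⊗ q ⟧ n ∎

⟦⟧-++ : ∀ p q n → ⟦ p ++ q ⟧ n ≡ ⟦ p ⟧ n + ⟦ q ⟧ n
⟦⟧-++ []            q n = sym (ℤ.+-identityˡ (⟦ q ⟧ n))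
⟦⟧-++ ((c , e) ∷ p) q n =
  trans (cong (_+_ (mono c e n)) (⟦⟧-++ p q n)) (sym (ℤ.+-assoc (mono c e n) (⟦ p ⟧ n) (⟦ q ⟧ n)))

⊙-⊙-eliminate : ∀ p q r₀ r (C G : Series) →
  (∀ n → (p ⊙ C) n ≡ ⟦ r₀ ⟧ n) → (∀ n → (p ⊙ G) n ≡ (q ⊙ C) n + ⟦ r ⟧ n) →
  ∀ n → (p ⊙ (p ⊙ G)) n ≡ ⟦ q ⊗ r₀ ⟧ n + ⟦ p ⊗ r ⟧ n
⊙-⊙-eliminate p q r₀ r C G pC pG n = begin
  (p ⊙ (p ⊙ G)) n                   ≡⟨ ⊙-cong p pG n ⟩
  (p ⊙ ((q ⊙ C) ⊕ ⟦ r ⟧)) n         ≡⟨ ⊙-⊕ p (q ⊙ C) ⟦ r ⟧ n ⟩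
  (p ⊙ (q ⊙ C)) n + (p ⊙ ⟦ r ⟧) n   ≡⟨ cong₂ _+_ (⊙-comm p q C n) (⊙-⟦⟧ p r n) ⟩
  (q ⊙ (p ⊙ C)) n + ⟦ p ⊗ r ⟧ n     ≡⟨ cong (_+ ⟦ p ⊗ r ⟧ n) (trans (⊙-cong q pC n) (⊙-⟦⟧ q r₀ n)) ⟩
  ⟦ q ⊗ r₀ ⟧ n + ⟦ p ⊗ r ⟧ n ∎

minusOne : Poly
minusOne = (- + 1 , 0) ∷ []

-- Coefficients depending on k are built from + k by ℤ operations, so that the ring solver sees k as a variable.
basePoly countRhs areaByCount areaRhs sperByCount sper⁺Rhs sperRhs numAreaPoly numSperPoly : ℕ → Poly
basePoly    k = (+ 1 , 0) ∷ (- + 2 , 1) ∷ (+ 1 , suc k) ∷ []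
countRhs    k = (+ 1 , 0) ∷ (- + 1 , k) ∷ []
areaByCount k = (+ 3 , 1) ∷ (- (+ 2 * + k + + 1) , suc k) ∷ []
areaRhs     k = (- (+ 2 * + k) , k) ∷ []
sperByCount k = (+ 2 , 1) ∷ (+ 1 , 2) ∷ (- (+ k + + 2) , suc k) ∷ []
sper⁺Rhs    k = (+ 1 , 0) ∷ (+ 1 , 1) ∷ (- (+ k + + 2) , k) ∷ []
sperRhs     k = sper⁺Rhs k ++ basePoly k ⊗ minusOne
numAreaPoly k = (+ 3 , 1) ∷ (- (+ 2 * + k) , k) ∷ (+ 2 * + k + - + 4 , suc k) ∷ (+ 1 , suc (k ℕ.+ k)) ∷ []
numSperPoly k = (+ 5 , 1) ∷ (- + 5 , 2) ∷ (- (+ 2 + + k) , k) ∷ (+ k + - + 1 , suc k) ∷ (+ 4 , suc (suc k))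
              ∷ (- + 1 , suc (suc (k ℕ.+ k))) ∷ []

base-⟦⟧ : ∀ k n → base k n ≡ ⟦ basePoly k ⟧ n
base-⟦⟧ k n = cong (λ x → mono (+ 1) 0 n + (mono (- + 2) 1 n + x))
                   (trans (cong (λ e → mono (+ 1) e n) (ℕ.+-comm k 1)) (sym (ℤ.+-identityʳ _)))

denom-⊛ : ∀ k (G : Series) n → (denom k ⊛ G) n ≡ (basePoly k ⊙ (basePoly k ⊙ G)) n
denom-⊛ k G n = begin
  (denom k ⊛ G) n                       ≡⟨ ⊛-cong {g = G} denom-⟦⟧ (λ _ → refl) n ⟩
  (⟦ basePoly k ⊗ basePoly k ⟧ ⊛ G) n   ≡⟨ ⟦⟧-⊛ (basePoly k ⊗ basePoly k) G n ⟩
  ((basePoly k ⊗ basePoly k) ⊙ G) n     ≡⟨ ⊗-⊙ (basePoly k) (basePoly k) G n ⟩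
  (basePoly k ⊙ (basePoly k ⊙ G)) n     ∎
  where
  denom-⟦⟧ : ∀ i → denom k i ≡ ⟦ basePoly k ⊗ basePoly k ⟧ i
  denom-⟦⟧ i = trans (⊛-cong (base-⟦⟧ k) (base-⟦⟧ k) i)
                     (trans (⟦⟧-⊛ (basePoly k) ⟦ basePoly k ⟧ i) (⊙-⟦⟧ (basePoly k) (basePoly k) i))

numArea-⟦⟧ : ∀ k n → numArea k n ≡ ⟦ numAreaPoly k ⟧ n
numArea-⟦⟧ k n =
  cong (_+_ (mono (+ 3) 1 n))
    (cong₂ _+_ (cong (λ c → mono (- c) k n) 2k)
      (cong₂ _+_ (cong₂ (λ c e → mono (c + - + 4) e n) 2k (ℕ.+-comm k 1))
                 (trans (cong (λ e → mono (+ 1) e n) 2k+1) (sym (ℤ.+-identityʳ _)))))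
  where
  2k : + (2 ℕ.* k) ≡ + 2 * + k
  2k = ℤ.pos-* 2 k
  2k+1 : 2 ℕ.* k ℕ.+ 1 ≡ suc (k ℕ.+ k)
  2k+1 = trans (ℕ.+-comm (2 ℕ.* k) 1) (cong (λ j → suc (k ℕ.+ j)) (ℕ.+-identityʳ k))

numSper-⟦⟧ : ∀ k n → numSper k n ≡ ⟦ numSperPoly k ⟧ n
numSper-⟦⟧ k n =
  cong (λ x → mono (+ 5) 1 n + (mono (- + 5) 2 n + (mono (- (+ 2 + + k)) k n + x)))
    (cong₂ _+_ (cong (λ e → mono (+ k + - + 1) e n) (ℕ.+-comm k 1))
      (cong₂ _+_ (cong (λ e → mono (+ 4) e n) (ℕ.+-comm k 2))
                 (trans (cong (λ e → mono (- + 1) e n) 2k+2) (sym (ℤ.+-identityʳ _)))))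
  where
  2k+2 : 2 ℕ.* k ℕ.+ 2 ≡ suc (suc (k ℕ.+ k))
  2k+2 = trans (ℕ.+-comm (2 ℕ.* k) 2) (cong (λ j → suc (suc (k ℕ.+ j))) (ℕ.+-identityʳ k))

Φ : (ℕ → ℤ) → Poly → ℤ
Φ φ []            = + 0
Φ φ ((c , e) ∷ p) = c * φ e + Φ φ p

⟦⟧-Φ : ∀ p n → ⟦ p ⟧ n ≡ Φ (λ e → mono (+ 1) e n) p
⟦⟧-Φ []            n = refl
⟦⟧-Φ ((c , e) ∷ p) n = cong₂ _+_ (mono-scale c e n) (⟦⟧-Φ p n)

⟦⟧-from-Φ : ∀ p q r → (∀ φ → Φ φ p + Φ φ q ≡ Φ φ r) → ∀ n → ⟦ p ⟧ n + ⟦ q ⟧ n ≡ ⟦ r ⟧ n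
⟦⟧-from-Φ p q r identity n =
  trans (cong₂ _+_ (⟦⟧-Φ p n) (⟦⟧-Φ q n)) (trans (identity (λ e → mono (+ 1) e n)) (sym (⟦⟧-Φ r n)))

-- Once the exponents k + 0, k + 1, ... produced by ⊗ are identified with k, suc k, ..., both
-- numerators are ring identities in k and the values of φ; the left-hand side of each identity is
-- the term-by-term expansion of the products, so that it matches the goal definitionally.
areaNumerator : ∀ k φ → Φ φ (areaByCount k ⊗ countRhs k) + Φ φ (basePoly k ⊗ areaRhs k) ≡ Φ φ (numAreaPoly k)
areaNumerator k φ with φ (suc (k ℕ.+ 0)) | cong (λ e → φ (suc e)) (ℕ.+-identityʳ k)
... | _ | refl = identity (+ k) (φ 1) (φ k) (φ (suc k)) (φ (suc (k ℕ.+ k)))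
  where
  identity : ∀ κ x¹ xᵏ xᵏ⁺¹ x²ᵏ⁺¹ →
      + 3 * + 1 * x¹ + (+ 3 * - + 1 * xᵏ⁺¹ + (- (+ 2 * κ + + 1) * + 1 * xᵏ⁺¹
        + (- (+ 2 * κ + + 1) * - + 1 * x²ᵏ⁺¹ + + 0)))
    + (+ 1 * - (+ 2 * κ) * xᵏ + (- + 2 * - (+ 2 * κ) * xᵏ⁺¹ + (+ 1 * - (+ 2 * κ) * x²ᵏ⁺¹ + + 0)))
    ≡ + 3 * x¹ + (- (+ 2 * κ) * xᵏ + ((+ 2 * κ + - + 4) * xᵏ⁺¹ + (+ 1 * x²ᵏ⁺¹ + + 0)))
  identity = solve-∀

sperNumerator : ∀ k φ → Φ φ (sperByCount k ⊗ countRhs k) + Φ φ (basePoly k ⊗ sperRhs k) ≡ Φ φ (numSperPoly k)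
sperNumerator k φ
  with φ (suc (k ℕ.+ 0)) | cong (λ e → φ (suc e)) (ℕ.+-identityʳ k)
     | φ (suc (suc (k ℕ.+ 0))) | cong (λ e → φ (suc (suc e))) (ℕ.+-identityʳ k)
     | φ (suc (k ℕ.+ 1)) | cong (λ e → φ (suc e)) (ℕ.+-comm k 1)
     | φ (suc (k ℕ.+ suc (k ℕ.+ 0))) | cong (λ e → φ (suc e)) (trans (cong (λ j → k ℕ.+ suc j) (ℕ.+-identityʳ k)) (ℕ.+-suc k k))
... | _ | refl | _ | refl | _ | refl | _ | refl =
  identity (+ k) (φ 0) (φ 1) (φ 2) (φ k) (φ (suc k)) (φ (suc (suc k))) (φ (suc (k ℕ.+ k))) (φ (suc (suc (k ℕ.+ k))))
  where
  identity : ∀ κ x⁰ x¹ x² xᵏ xᵏ⁺¹ xᵏ⁺² x²ᵏ⁺¹ x²ᵏ⁺² →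
      + 2 * + 1 * x¹ + (+ 2 * - + 1 * xᵏ⁺¹ + (+ 1 * + 1 * x² + (+ 1 * - + 1 * xᵏ⁺²
        + (- (κ + + 2) * + 1 * xᵏ⁺¹ + (- (κ + + 2) * - + 1 * x²ᵏ⁺¹ + + 0)))))
    + (+ 1 * + 1 * x⁰ + (+ 1 * + 1 * x¹ + (+ 1 * - (κ + + 2) * xᵏ + (+ 1 * (+ 1 * - + 1) * x⁰
        + (+ 1 * (- + 2 * - + 1) * x¹ + (+ 1 * (+ 1 * - + 1) * xᵏ⁺¹
        + (- + 2 * + 1 * x¹ + (- + 2 * + 1 * x² + (- + 2 * - (κ + + 2) * xᵏ⁺¹ + (- + 2 * (+ 1 * - + 1) * x¹
        + (- + 2 * (- + 2 * - + 1) * x² + (- + 2 * (+ 1 * - + 1) * xᵏ⁺²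
        + (+ 1 * + 1 * xᵏ⁺¹ + (+ 1 * + 1 * xᵏ⁺² + (+ 1 * - (κ + + 2) * x²ᵏ⁺¹ + (+ 1 * (+ 1 * - + 1) * xᵏ⁺¹
        + (+ 1 * (- + 2 * - + 1) * xᵏ⁺² + (+ 1 * (+ 1 * - + 1) * x²ᵏ⁺² + + 0))))))))))))))))))
    ≡ + 5 * x¹ + (- + 5 * x² + (- (+ 2 + κ) * xᵏ + ((κ + - + 1) * xᵏ⁺¹ + (+ 4 * xᵏ⁺² + (- + 1 * x²ᵏ⁺² + + 0)))))
  identity = solve-∀

sumWords : ℕ → (Word → ℤ) → ℤ
sumWords zero    h = h []
sumWords (suc n) h = sumWords n (h ∘ (false ∷_)) + sumWords n (h ∘ (true ∷_))

sumWords-cong : ∀ n {g h : Word → ℤ} → (∀ w → g w ≡ h w) → sumWords n g ≡ sumWords n h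
sumWords-cong zero    g≡h = g≡h []
sumWords-cong (suc n) g≡h =
  cong₂ _+_ (sumWords-cong n (g≡h ∘ (false ∷_))) (sumWords-cong n (g≡h ∘ (true ∷_)))

sumWords-zero : ∀ n → sumWords n (λ _ → + 0) ≡ + 0
sumWords-zero zero    = refl
sumWords-zero (suc n) = cong₂ _+_ (sumWords-zero n) (sumWords-zero n)

sumWords-+ : ∀ n (g h : Word → ℤ) → sumWords n (λ w → g w + h w) ≡ sumWords n g + sumWords n h
sumWords-+ zero    g h = refl
sumWords-+ (suc n) g h =
  trans (cong₂ _+_ (sumWords-+ n (g ∘ (false ∷_)) (h ∘ (false ∷_)))
                   (sumWords-+ n (g ∘ (true ∷_)) (h ∘ (true ∷_))))
        (interchange (sumWords n (g ∘ (false ∷_))) (sumWords n (h ∘ (false ∷_)))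
                     (sumWords n (g ∘ (true ∷_))) (sumWords n (h ∘ (true ∷_))))

sumWords-* : ∀ n c (h : Word → ℤ) → sumWords n (λ w → c * h w) ≡ c * sumWords n h
sumWords-* zero    c h = refl
sumWords-* (suc n) c h =
  trans (cong₂ _+_ (sumWords-* n c (h ∘ (false ∷_))) (sumWords-* n c (h ∘ (true ∷_))))
        (sym (ℤ.*-distribˡ-+ c _ _))

when : Bool → ℤ → ℤ
when true  x = x
when false x = + 0

ones : ℕ → Word
ones j = replicate j true

sumWords-startsWithOnes : ∀ j n (h : Word → ℤ) →
  sumWords n (λ u → when (startsWithOnes j u) (h u)) ≡ shift j (λ m → sumWords m (λ v → h (ones j ++ v))) n
sumWords-startsWithOnes zero    n       h = refl
sumWords-startsWithOnes (suc j) zero    h = refl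
sumWords-startsWithOnes (suc j) (suc n) h =
  trans (cong (_+ sumWords n (λ u → when (startsWithOnes j u) (h (true ∷ u)))) (sumWords-zero n))
        (trans (ℤ.+-identityˡ _) (sumWords-startsWithOnes j n (h ∘ (true ∷_))))

startsWithOnes-ones : ∀ j w → startsWithOnes j (ones j ++ w) ≡ true
startsWithOnes-ones zero    w = refl
startsWithOnes-ones (suc j) w = startsWithOnes-ones j w

startsWithOnes-ones++ : ∀ j m w → startsWithOnes (j ℕ.+ m) (ones j ++ w) ≡ startsWithOnes m w
startsWithOnes-ones++ zero    m w = refl
startsWithOnes-ones++ (suc j) m w = startsWithOnes-ones++ j m w

ones-∷ʳ : ∀ j v → ones j ++ true ∷ v ≡ true ∷ (ones j ++ v)
ones-∷ʳ zero    v = refl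
ones-∷ʳ (suc j) v = cong (true ∷_) (ones-∷ʳ j v)

sumOver : ∀ {A : Set} → List A → (A → ℤ) → ℤ
sumOver []       f = + 0
sumOver (x ∷ xs) f = f x + sumOver xs f

sumOver-++ : ∀ {A : Set} (xs ys : List A) (f : A → ℤ) → sumOver (xs ++ ys) f ≡ sumOver xs f + sumOver ys f
sumOver-++ []       ys f = sym (ℤ.+-identityˡ _)
sumOver-++ (x ∷ xs) ys f = trans (cong (_+_ (f x)) (sumOver-++ xs ys f)) (sym (ℤ.+-assoc (f x) _ _))

sumOver-map : ∀ {A B : Set} (g : A → B) (xs : List A) (f : B → ℤ) → sumOver (map g xs) f ≡ sumOver xs (f ∘ g)
sumOver-map g []       f = refl
sumOver-map g (x ∷ xs) f = cong (_+_ (f (g x))) (sumOver-map g xs f)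

sumOver-words : ∀ n (h : Word → ℤ) → sumOver (words n) h ≡ sumWords n h
sumOver-words zero    h = ℤ.+-identityʳ (h [])
sumOver-words (suc n) h =
  trans (sumOver-++ (map (false ∷_) (words n)) (map (true ∷_) (words n)) h)
        (cong₂ _+_ (trans (sumOver-map (false ∷_) (words n) h) (sumOver-words n (h ∘ (false ∷_))))
                   (trans (sumOver-map (true ∷_) (words n) h) (sumOver-words n (h ∘ (true ∷_)))))

sum-filter : ∀ {A : Set} (P : A → Bool) (f : A → ℕ) xs →
  + sum (map f (filter (λ x → P x ≟𝔹 true) xs)) ≡ sumOver xs (λ x → when (P x) (+ f x))
sum-filter P f []       = refl
sum-filter P f (x ∷ xs) with P x
... | true  = cong (_+_ (+ f x)) (sum-filter P f xs)
... | false = trans (sum-filter P f xs) (sym (ℤ.+-identityˡ _))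

area-ones++ : ∀ j w → area (ones j ++ w) ≡ 2 ℕ.* j ℕ.+ area w
area-ones++ zero    w = refl
area-ones++ (suc j) w = begin
  2 ℕ.+ area (ones j ++ w)      ≡⟨ cong (2 ℕ.+_) (area-ones++ j w) ⟩
  2 ℕ.+ (2 ℕ.* j ℕ.+ area w)    ≡⟨ ℕ.+-assoc 2 (2 ℕ.* j) (area w) ⟨
  2 ℕ.+ 2 ℕ.* j ℕ.+ area w      ≡⟨ cong (ℕ._+ area w) (ℕ.*-suc 2 j) ⟨
  2 ℕ.* suc j ℕ.+ area w        ∎

-- 1 if a letter 1 placed in front of the word ends a block of 1's
endsBlock : Word → ℕ
endsBlock (true ∷ _) = 0
endsBlock _          = 1

blocks : Word → ℕ
blocks []          = 0
blocks (false ∷ u) = blocks u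
blocks (true ∷ u)  = endsBlock u ℕ.+ blocks u

-- agrees with sper on nonempty words (sper-∷), but is 1 on the empty word
sper⁺ : Word → ℕ
sper⁺ w = length w ℕ.+ 1 ℕ.+ blocks w

blocks-ones++ : ∀ j w → blocks (ones (suc j) ++ w) ≡ endsBlock w ℕ.+ blocks w
blocks-ones++ zero    w = refl
blocks-ones++ (suc j) w = blocks-ones++ j w

sper⁺-ones++ : ∀ j w → sper⁺ (ones (suc j) ++ w) ≡ suc j ℕ.+ sper⁺ w ℕ.+ endsBlock w
sper⁺-ones++ j w = begin
  length (ones (suc j) ++ w) ℕ.+ 1 ℕ.+ blocks (ones (suc j) ++ w)
    ≡⟨ cong₂ (λ l b → l ℕ.+ 1 ℕ.+ b)
             (trans (length-++ (ones (suc j))) (cong (ℕ._+ length w) (length-replicate (suc j))))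
             (blocks-ones++ j w) ⟩
  suc j ℕ.+ length w ℕ.+ 1 ℕ.+ (endsBlock w ℕ.+ blocks w)
    ≡⟨ regroup (suc j) (length w) (endsBlock w) (blocks w) ⟩
  suc j ℕ.+ sper⁺ w ℕ.+ endsBlock w ∎
  where regroup : ∀ j l e b → j ℕ.+ l ℕ.+ 1 ℕ.+ (e ℕ.+ b) ≡ j ℕ.+ (l ℕ.+ 1 ℕ.+ b) ℕ.+ e
        regroup = ℕ-solve-∀

-- Each block of 1's raises the vertical boundary by one unit on each of its two sides.
verticalEdges : ∀ b u → let hs = heights (b ∷ u) in
  firstH hs ℕ.+ lastH hs ℕ.+ jumps hs ≡ 2 ℕ.+ 2 ℕ.* blocks (b ∷ u)
verticalEdges false []          = refl
verticalEdges true  []          = refl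
verticalEdges false (false ∷ u) = verticalEdges false u
verticalEdges true  (true ∷ u)  = verticalEdges true u
verticalEdges false (true ∷ u)  =
  trans (cong suc (ℕ.+-suc (lastH (heights (true ∷ u))) (jumps (heights (true ∷ u)))))
        (verticalEdges true u)
verticalEdges true  (false ∷ u) =
  trans (cong (λ x → suc (suc x)) (ℕ.+-suc (lastH (heights (false ∷ u))) (jumps (heights (false ∷ u)))))
        (trans (cong (2 ℕ.+_) (verticalEdges false u)) (cong (2 ℕ.+_) (sym (ℕ.*-suc 2 (blocks u)))))

sper-∷ : ∀ b u → sper (b ∷ u) ≡ sper⁺ (b ∷ u)
sper-∷ b u = trans (cong (ℕ._/ 2) perimeter≡) (m*n/n≡m (sper⁺ (b ∷ u)) 2)
  where
  hs = heights (b ∷ u)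
  l = length (b ∷ u)
  perimeter≡ : perimeter (b ∷ u) ≡ sper⁺ (b ∷ u) ℕ.* 2
  perimeter≡ = begin
    2 ℕ.* l ℕ.+ firstH hs ℕ.+ lastH hs ℕ.+ jumps hs
      ≡⟨ assoc (2 ℕ.* l) (firstH hs) (lastH hs) (jumps hs) ⟩
    2 ℕ.* l ℕ.+ (firstH hs ℕ.+ lastH hs ℕ.+ jumps hs)
      ≡⟨ cong (2 ℕ.* l ℕ.+_) (verticalEdges b u) ⟩
    2 ℕ.* l ℕ.+ (2 ℕ.+ 2 ℕ.* blocks (b ∷ u))
      ≡⟨ double l (blocks (b ∷ u)) ⟩
    sper⁺ (b ∷ u) ℕ.* 2 ∎
    where
    assoc : ∀ a b c d → a ℕ.+ b ℕ.+ c ℕ.+ d ≡ a ℕ.+ (b ℕ.+ c ℕ.+ d)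
    assoc = ℕ-solve-∀
    double : ∀ l b → 2 ℕ.* l ℕ.+ (2 ℕ.+ 2 ℕ.* b) ≡ (l ℕ.+ 1 ℕ.+ b) ℕ.* 2
    double = ℕ-solve-∀

isolate : ∀ x y {z} → x + y ≡ z → x ≡ z - y
isolate x y refl = sym (trans (ℤ.+-assoc x y (- y)) (trans (cong (_+_ x) (ℤ.+-inverseʳ y)) (ℤ.+-identityʳ x)))

module Avoiding (K : ℕ) where

  k : ℕ
  k = suc K

  avoids : Word → Bool
  avoids w = not (containsOnes k w)

  sumAvoiding : ℕ → (Word → ℤ) → ℤ
  sumAvoiding n X = sumWords n (λ w → when (avoids w) (X w))

  count : Series
  count n = sumAvoiding n (λ _ → + 1)

  -- j + suc i ≡ k says j < k, in a form that survives the induction on j.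
  containsOnes-ones++ : ∀ j i w → j ℕ.+ suc i ≡ k → (∀ m → startsWithOnes (suc m) w ≡ false) →
                        containsOnes k (ones j ++ w) ≡ containsOnes k w
  containsOnes-ones++ zero    i w j+1+i≡k noOne = refl
  containsOnes-ones++ (suc j) i w j+1+i≡k noOne =
    cong₂ _∨_ noBlock (containsOnes-ones++ j (suc i) w (trans (ℕ.+-suc j (suc i)) j+1+i≡k) noOne)
    where
    noBlock : startsWithOnes k (ones (suc j) ++ w) ≡ false
    noBlock = trans (cong (λ l → startsWithOnes l (ones (suc j) ++ w)) (sym j+1+i≡k))
                    (trans (startsWithOnes-ones++ (suc j) (suc i) w) (noOne i))

  avoids-ones++ : ∀ w → (∀ m → startsWithOnes (suc m) w ≡ false) → avoids (ones K ++ w) ≡ avoids w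
  avoids-ones++ w noOne = cong not (containsOnes-ones++ K 0 w (ℕ.+-comm K 1) noOne)

  avoids-ones++true : ∀ v → avoids (ones K ++ true ∷ v) ≡ false
  avoids-ones++true v =
    trans (cong (λ w → not (containsOnes k w)) (ones-∷ʳ K v))
          (cong (λ b → not (b ∨ containsOnes k (ones K ++ v))) (startsWithOnes-ones K v))

  -- Behind a prefix of K ones an avoiding word is either empty or continues with a 0.
  sumAvoiding-behind-ones : ∀ m (Z : Word → ℤ) →
    sumWords m (λ v → when (avoids (ones K ++ v)) (Z v))
      ≡ mono (Z []) 0 m + shift 1 (λ j → sumAvoiding j (Z ∘ (false ∷_))) m
  sumAvoiding-behind-ones zero    Z =
    trans (cong (λ b → when b (Z [])) (avoids-ones++ [] (λ _ → refl))) (sym (ℤ.+-identityʳ (Z [])))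
  sumAvoiding-behind-ones (suc m) Z = begin
    sumWords m (λ v → when (avoids (ones K ++ false ∷ v)) (Z (false ∷ v)))
      + sumWords m (λ v → when (avoids (ones K ++ true ∷ v)) (Z (true ∷ v)))
      ≡⟨ cong₂ _+_ (sumWords-cong m (λ v → cong (λ b → when b (Z (false ∷ v))) (avoids-ones++ (false ∷ v) (λ _ → refl))))
                   (trans (sumWords-cong m (λ v → cong (λ b → when b (Z (true ∷ v))) (avoids-ones++true v)))
                          (sumWords-zero m)) ⟩
    sumAvoiding m (Z ∘ (false ∷_)) + + 0
      ≡⟨ ℤ.+-identityʳ _ ⟩
    sumAvoiding m (Z ∘ (false ∷_))
      ≡⟨ ℤ.+-identityˡ _ ⟨
    + 0 + sumAvoiding m (Z ∘ (false ∷_)) ∎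

  sumAvoiding-startsWithOnes : ∀ n (h : Word → ℤ) →
    sumWords n (λ u → when (startsWithOnes K u) (when (avoids u) (h u)))
      ≡ mono (h (ones K)) K n + shift k (λ m → sumAvoiding m (λ v → h (ones K ++ false ∷ v))) n
  sumAvoiding-startsWithOnes n h = begin
    sumWords n (λ u → when (startsWithOnes K u) (when (avoids u) (h u)))
      ≡⟨ sumWords-startsWithOnes K n (λ u → when (avoids u) (h u)) ⟩
    shift K (λ m → sumWords m (λ v → when (avoids (ones K ++ v)) (h (ones K ++ v)))) n
      ≡⟨ shift-cong K (λ m → sumAvoiding-behind-ones m (h ∘ (ones K ++_))) n ⟩
    shift K (mono (h (ones K ++ [])) 0 ⊕ shift 1 tails) n
      ≡⟨ shift-⊕ K (mono (h (ones K ++ [])) 0) (shift 1 tails) n ⟩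
    shift K (mono (h (ones K ++ [])) 0) n + shift K (shift 1 tails) n
      ≡⟨ cong₂ _+_ (shift-mono K (h (ones K ++ [])) 0 n) (shift-shift K 1 tails n) ⟩
    mono (h (ones K ++ [])) (K ℕ.+ 0) n + shift (K ℕ.+ 1) tails n
      ≡⟨ cong₂ _+_ (cong₂ (λ c e → mono c e n) (cong h (++-identityʳ (ones K))) (ℕ.+-identityʳ K))
                   (cong (λ e → shift e tails n) (ℕ.+-comm K 1)) ⟩
    mono (h (ones K)) K n + shift k tails n ∎
    where tails = λ m → sumAvoiding m (λ v → h (ones K ++ false ∷ v))

  -- A word 1u avoids 1^k iff u avoids 1^k and does not start with 1^K.
  sumAvoiding-split : ∀ n (X : Word → ℤ) →
    sumAvoiding (suc n) X + sumWords n (λ u → when (startsWithOnes K u) (when (avoids u) (X (true ∷ u))))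
      ≡ sumAvoiding n (X ∘ (false ∷_)) + sumAvoiding n (X ∘ (true ∷_))
  sumAvoiding-split n X =
    trans (ℤ.+-assoc (sumAvoiding n (X ∘ (false ∷_))) _ _)
          (cong (_+_ (sumAvoiding n (X ∘ (false ∷_))))
                (trans (sym (sumWords-+ n _ _))
                       (sumWords-cong n (λ u → cases (startsWithOnes K u) (containsOnes k u) (X (true ∷ u))))))
    where
    cases : ∀ s c x → when (not (s ∨ c)) x + when s (when (not c) x) ≡ when (not c) x
    cases true  true  x = refl
    cases true  false x = ℤ.+-identityˡ x
    cases false true  x = refl
    cases false false x = ℤ.+-identityʳ x

  sumAvoiding-suc : ∀ n (X : Word → ℤ) →
    sumAvoiding (suc n) X
      + (mono (X (ones k)) K n + shift k (λ m → sumAvoiding m (λ v → X (ones k ++ false ∷ v))) n)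
      ≡ sumAvoiding n (X ∘ (false ∷_)) + sumAvoiding n (X ∘ (true ∷_))
  sumAvoiding-suc n X =
    trans (cong (_+_ (sumAvoiding (suc n) X)) (sym (sumAvoiding-startsWithOnes n (X ∘ (true ∷_)))))
          (sumAvoiding-split n X)

  sumAvoiding-cong : ∀ n {X Y : Word → ℤ} → (∀ w → X w ≡ Y w) → sumAvoiding n X ≡ sumAvoiding n Y
  sumAvoiding-cong n X≡Y = sumWords-cong n (λ w → cong (when (avoids w)) (X≡Y w))

  sumAvoiding-+ : ∀ n (X Y : Word → ℤ) → sumAvoiding n (λ w → X w + Y w) ≡ sumAvoiding n X + sumAvoiding n Y
  sumAvoiding-+ n X Y = trans (sumWords-cong n (λ w → when-+ (avoids w) (X w) (Y w))) (sumWords-+ n _ _)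
    where
    when-+ : ∀ b x y → when b (x + y) ≡ when b x + when b y
    when-+ true  x y = refl
    when-+ false x y = refl

  sumAvoiding-const : ∀ n c → sumAvoiding n (λ _ → c) ≡ c * count n
  sumAvoiding-const n c = trans (sumWords-cong n (λ w → when-const (avoids w))) (sumWords-* n c _)
    where
    when-const : ∀ b → when b c ≡ c * when b (+ 1)
    when-const true  = sym (ℤ.*-identityʳ c)
    when-const false = sym (ℤ.*-zeroʳ c)

  sumAvoiding-const+ : ∀ n c (X : Word → ℤ) → sumAvoiding n (λ w → c + X w) ≡ c * count n + sumAvoiding n X
  sumAvoiding-const+ n c X = trans (sumAvoiding-+ n (λ _ → c) X) (cong (_+ sumAvoiding n X) (sumAvoiding-const n c))

  module LinearStatistic (X Y : Word → ℤ) (a b c d : ℤ)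
    (X-0∷ : ∀ u → X (false ∷ u) ≡ a + X u) (X-1∷ : ∀ u → X (true ∷ u) ≡ b + X u + Y u)
    (X-1ᵏ : X (ones k) ≡ c) (X-1ᵏ0∷ : ∀ v → X (ones k ++ false ∷ v) ≡ d + X v) where

    total : Series
    total n = sumAvoiding n X

    total-suc : ∀ m → total (suc m) + (c * mono (+ 1) K m + (d * shift k count m + shift k total m))
                      ≡ (a * count m + total m) + (b * count m + total m + sumAvoiding m Y)
    total-suc m = begin
      total (suc m) + (c * mono (+ 1) K m + (d * shift k count m + shift k total m))
        ≡⟨ cong (_+_ (total (suc m))) (cong₂ _+_ onesOnly onesThen0) ⟨
      total (suc m) + (mono (X (ones k)) K m + shift k (λ j → sumAvoiding j (λ v → X (ones k ++ false ∷ v))) m)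
        ≡⟨ sumAvoiding-suc m X ⟩
      sumAvoiding m (X ∘ (false ∷_)) + sumAvoiding m (X ∘ (true ∷_))
        ≡⟨ cong₂ _+_ startsWith0 startsWith1 ⟩
      (a * count m + total m) + (b * count m + total m + sumAvoiding m Y) ∎
      where
      startsWith0 : sumAvoiding m (X ∘ (false ∷_)) ≡ a * count m + total m
      startsWith0 = trans (sumAvoiding-cong m X-0∷) (sumAvoiding-const+ m a X)

      startsWith1 : sumAvoiding m (X ∘ (true ∷_)) ≡ b * count m + total m + sumAvoiding m Y
      startsWith1 = trans (sumAvoiding-cong m X-1∷)
                          (trans (sumAvoiding-+ m (λ u → b + X u) Y)
                                 (cong (_+ sumAvoiding m Y) (sumAvoiding-const+ m b X)))

      onesOnly : mono (X (ones k)) K m ≡ c * mono (+ 1) K m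
      onesOnly = trans (cong (λ x → mono x K m) X-1ᵏ) (mono-scale c K m)

      onesThen0 : shift k (λ j → sumAvoiding j (λ v → X (ones k ++ false ∷ v))) m
                  ≡ d * shift k count m + shift k total m
      onesThen0 = begin
        shift k (λ j → sumAvoiding j (λ v → X (ones k ++ false ∷ v))) m
          ≡⟨ shift-cong k (λ j → trans (sumAvoiding-cong j X-1ᵏ0∷) (sumAvoiding-const+ j d X)) m ⟩
        shift k ((λ j → d * count j) ⊕ total) m
          ≡⟨ shift-⊕ k (λ j → d * count j) total m ⟩
        shift k (λ j → d * count j) m + shift k total m
          ≡⟨ cong (_+ shift k total m) (shift-* k d count m) ⟩
        d * shift k count m + shift k total m ∎

    basePoly-⊙-total : ∀ m → (basePoly k ⊙ total) (suc m)
                       ≡ (a + b) * count m + sumAvoiding m Y - (c * mono (+ 1) K m + d * shift k count m)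
    basePoly-⊙-total m = begin
      + 1 * total (suc m) + (- + 2 * total m + (+ 1 * t + + 0))
        ≡⟨ cong (λ x → + 1 * x + (- + 2 * total m + (+ 1 * t + + 0)))
                (isolate (total (suc m)) (c * M + (d * s + t)) (total-suc m)) ⟩
      + 1 * ((a * count m + total m) + (b * count m + total m + sumAvoiding m Y) - (c * M + (d * s + t)))
        + (- + 2 * total m + (+ 1 * t + + 0))
        ≡⟨ collect (count m) (total m) (sumAvoiding m Y) M s t a b c d ⟩
      (a + b) * count m + sumAvoiding m Y - (c * M + d * s) ∎
      where
      M = mono (+ 1) K m
      s = shift k count m
      t = shift k total m
      collect : ∀ C g y M s t a b c d →
        + 1 * ((a * C + g) + (b * C + g + y) - (c * M + (d * s + t))) + (- + 2 * g + (+ 1 * t + + 0))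
          ≡ (a + b) * C + y - (c * M + d * s)
      collect = solve-∀

  count-recurrence : ∀ n → (basePoly k ⊙ count) n ≡ ⟦ countRhs k ⟧ n
  count-recurrence zero    = refl
  count-recurrence (suc m) = begin
    (basePoly k ⊙ count) (suc m)
      ≡⟨ LinearStatistic.basePoly-⊙-total (λ _ → + 1) (λ _ → + 0) (+ 0) (+ 0) (+ 1) (+ 0)
                          (λ _ → refl) (λ _ → refl) refl (λ _ → refl) m ⟩
    (+ 0 + + 0) * count m + sumAvoiding m (λ _ → + 0) - (+ 1 * M + + 0 * shift k count m)
      ≡⟨ cong (λ y → (+ 0 + + 0) * count m + y - (+ 1 * M + + 0 * shift k count m)) (sumAvoiding-const m (+ 0)) ⟩
    (+ 0 + + 0) * count m + + 0 * count m - (+ 1 * M + + 0 * shift k count m)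
      ≡⟨ collect (count m) M (shift k count m) ⟩
    + 0 + (- + 1 * M + + 0)
      ≡⟨ cong (λ x → + 0 + (x + + 0)) (trans (mono-suc (- + 1) K m) (mono-scale (- + 1) K m)) ⟨
    ⟦ countRhs k ⟧ (suc m) ∎
    where
    M = mono (+ 1) K m
    collect : ∀ C M s → (+ 0 + + 0) * C + + 0 * C - (+ 1 * M + + 0 * s) ≡ + 0 + (- + 1 * M + + 0)
    collect = solve-∀

  areaTotal : Series
  areaTotal n = sumAvoiding n (λ w → + area w)

  areaTotal-recurrence : ∀ n → (basePoly k ⊙ areaTotal) n ≡ (areaByCount k ⊙ count) n + ⟦ areaRhs k ⟧ n
  areaTotal-recurrence zero    =
    sym (cong (λ x → + 3 * + 0 + (x + + 0) + ⟦ areaRhs k ⟧ 0) (ℤ.*-zeroʳ (- (+ 2 * + k + + 1))))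
  areaTotal-recurrence (suc m) = begin
    (basePoly k ⊙ areaTotal) (suc m)
      ≡⟨ LinearStatistic.basePoly-⊙-total (λ w → + area w) (λ _ → + 0) (+ 1) (+ 2) (+ 2 * + k) (+ 2 * + k + + 1)
                          (λ _ → refl) (λ u → sym (ℤ.+-identityʳ _)) areaOnes areaOnes0 m ⟩
    (+ 1 + + 2) * count m + sumAvoiding m (λ _ → + 0) - (+ 2 * + k * M + (+ 2 * + k + + 1) * s)
      ≡⟨ cong (λ y → (+ 1 + + 2) * count m + y - (+ 2 * + k * M + (+ 2 * + k + + 1) * s)) (sumAvoiding-const m (+ 0)) ⟩
    (+ 1 + + 2) * count m + + 0 * count m - (+ 2 * + k * M + (+ 2 * + k + + 1) * s)
      ≡⟨ collect (+ k) (count m) M s ⟩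
    (+ 3 * count m + (- (+ 2 * + k + + 1) * s + + 0)) + (- (+ 2 * + k) * M + + 0)
      ≡⟨ cong (λ x → (areaByCount k ⊙ count) (suc m) + (x + + 0))
              (trans (mono-suc (- (+ 2 * + k)) K m) (mono-scale (- (+ 2 * + k)) K m)) ⟨
    (areaByCount k ⊙ count) (suc m) + ⟦ areaRhs k ⟧ (suc m) ∎
    where
    M = mono (+ 1) K m
    s = shift k count m
    areaOnes : + area (ones k) ≡ + 2 * + k
    areaOnes = trans (cong +_ (trans (cong area (sym (++-identityʳ (ones k))))
                                     (trans (area-ones++ k []) (ℕ.+-identityʳ _))))
                     (ℤ.pos-* 2 k)
    areaOnes0 : ∀ v → + area (ones k ++ false ∷ v) ≡ + 2 * + k + + 1 + + area v
    areaOnes0 v = trans (cong +_ (trans (area-ones++ k (false ∷ v)) (sym (ℕ.+-assoc (2 ℕ.* k) 1 (area v)))))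
                        (cong (λ z → z + + 1 + + area v) (ℤ.pos-* 2 k))
    collect : ∀ κ C M s → (+ 1 + + 2) * C + + 0 * C - (+ 2 * κ * M + (+ 2 * κ + + 1) * s)
                          ≡ (+ 3 * C + (- (+ 2 * κ + + 1) * s + + 0)) + (- (+ 2 * κ) * M + + 0)
    collect = solve-∀

  sumAvoiding-endsBlock : ∀ n → sumAvoiding n (λ u → + endsBlock u) ≡ mono (+ 1) 0 n + shift 1 count n
  sumAvoiding-endsBlock zero    = refl
  sumAvoiding-endsBlock (suc m) =
    trans (cong (_+_ (count m)) (trans (sumWords-cong m (λ u → when-zero (avoids (true ∷ u)))) (sumWords-zero m)))
          (trans (ℤ.+-identityʳ (count m)) (sym (ℤ.+-identityˡ (count m))))
    where
    when-zero : ∀ b → when b (+ 0) ≡ + 0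
    when-zero true  = refl
    when-zero false = refl

  sperTotal : Series
  sperTotal n = sumAvoiding n (λ w → + sper⁺ w)

  sperTotal-recurrence : ∀ n → (basePoly k ⊙ sperTotal) n ≡ (sperByCount k ⊙ count) n + ⟦ sper⁺Rhs k ⟧ n
  sperTotal-recurrence zero    =
    sym (cong (λ x → + 2 * + 0 + (+ 1 * + 0 + (x + + 0)) + ⟦ sper⁺Rhs k ⟧ 0) (ℤ.*-zeroʳ (- (+ k + + 2))))
  sperTotal-recurrence (suc m) = begin
    (basePoly k ⊙ sperTotal) (suc m)
      ≡⟨ LinearStatistic.basePoly-⊙-total (λ w → + sper⁺ w) (λ u → + endsBlock u) (+ 1) (+ 1) (+ k + + 2) (+ k + + 2)
                          (λ _ → refl) (λ u → cong +_ (sper⁺-ones++ 0 u)) sperOnes sperOnes0 m ⟩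
    (+ 1 + + 1) * count m + sumAvoiding m (λ u → + endsBlock u) - ((+ k + + 2) * M + (+ k + + 2) * s)
      ≡⟨ cong (λ y → (+ 1 + + 1) * count m + y - ((+ k + + 2) * M + (+ k + + 2) * s)) (sumAvoiding-endsBlock m) ⟩
    (+ 1 + + 1) * count m + (M₀ + s₁) - ((+ k + + 2) * M + (+ k + + 2) * s)
      ≡⟨ collect (+ k) (count m) M₀ s₁ M s ⟩
    (+ 2 * count m + (+ 1 * s₁ + (- (+ k + + 2) * s + + 0))) + (+ 0 + (M₀ + (- (+ k + + 2) * M + + 0)))
      ≡⟨ cong₂ (λ x y → (sperByCount k ⊙ count) (suc m) + (+ 0 + (x + (y + + 0))))
               (mono-suc (+ 1) 0 m) (trans (mono-suc (- (+ k + + 2)) K m) (mono-scale (- (+ k + + 2)) K m)) ⟨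
    (sperByCount k ⊙ count) (suc m) + ⟦ sper⁺Rhs k ⟧ (suc m) ∎
    where
    M = mono (+ 1) K m
    M₀ = mono (+ 1) 0 m
    s = shift k count m
    s₁ = shift 1 count m
    sperOnes : + sper⁺ (ones k) ≡ + k + + 2
    sperOnes = cong +_ (trans (cong sper⁺ (sym (++-identityʳ (ones k))))
                              (trans (sper⁺-ones++ K []) (ℕ.+-assoc k 1 1)))
    sperOnes0 : ∀ v → + sper⁺ (ones k ++ false ∷ v) ≡ + k + + 2 + + sper⁺ v
    sperOnes0 v = cong +_ (trans (sper⁺-ones++ K (false ∷ v)) (regroup k (sper⁺ v)))
      where regroup : ∀ k s → k ℕ.+ suc s ℕ.+ 1 ≡ k ℕ.+ 2 ℕ.+ s
            regroup = ℕ-solve-∀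
    collect : ∀ κ C M₀ s₁ M s → (+ 1 + + 1) * C + (M₀ + s₁) - ((κ + + 2) * M + (κ + + 2) * s)
                ≡ (+ 2 * C + (+ 1 * s₁ + (- (κ + + 2) * s + + 0))) + (+ 0 + (M₀ + (- (κ + + 2) * M + + 0)))
    collect = solve-∀

  gfStat-suc : ∀ (stat : Word → ℕ) n → gfStat stat k (suc n) ≡ sumAvoiding (suc n) (λ w → + stat w)
  gfStat-suc stat n = trans (sum-filter avoids stat (words (suc n))) (sumOver-words (suc n) _)

  areaGF≗areaTotal : ∀ n → areaGF k n ≡ areaTotal n
  areaGF≗areaTotal zero    = refl
  areaGF≗areaTotal (suc n) = gfStat-suc area n

  sperGF≗sperTotal-1 : ∀ n → sperGF k n ≡ sperTotal n + ⟦ minusOne ⟧ n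
  sperGF≗sperTotal-1 zero    = refl
  sperGF≗sperTotal-1 (suc n) = begin
    sperGF k (suc n)
      ≡⟨ gfStat-suc sper n ⟩
    sumAvoiding (suc n) (λ w → + sper w)
      ≡⟨ cong₂ _+_ (sumWords-cong n (λ u → cong (λ x → when (avoids (false ∷ u)) (+ x)) (sper-∷ false u)))
                   (sumWords-cong n (λ u → cong (λ x → when (avoids (true ∷ u)) (+ x)) (sper-∷ true u))) ⟩
    sperTotal (suc n)
      ≡⟨ ℤ.+-identityʳ _ ⟨
    sperTotal (suc n) + + 0 ∎

  areaGF-recurrence : ∀ n → (basePoly k ⊙ areaGF k) n ≡ (areaByCount k ⊙ count) n + ⟦ areaRhs k ⟧ n
  areaGF-recurrence n = trans (⊙-cong (basePoly k) areaGF≗areaTotal n) (areaTotal-recurrence n)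

  sperGF-recurrence : ∀ n → (basePoly k ⊙ sperGF k) n ≡ (sperByCount k ⊙ count) n + ⟦ sperRhs k ⟧ n
  sperGF-recurrence n = begin
    (basePoly k ⊙ sperGF k) n
      ≡⟨ ⊙-cong (basePoly k) sperGF≗sperTotal-1 n ⟩
    (basePoly k ⊙ (sperTotal ⊕ ⟦ minusOne ⟧)) n
      ≡⟨ ⊙-⊕ (basePoly k) sperTotal ⟦ minusOne ⟧ n ⟩
    (basePoly k ⊙ sperTotal) n + (basePoly k ⊙ ⟦ minusOne ⟧) n
      ≡⟨ cong₂ _+_ (sperTotal-recurrence n) (⊙-⟦⟧ (basePoly k) minusOne n) ⟩
    (sperByCount k ⊙ count) n + ⟦ sper⁺Rhs k ⟧ n + ⟦ basePoly k ⊗ minusOne ⟧ n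
      ≡⟨ ℤ.+-assoc ((sperByCount k ⊙ count) n) _ _ ⟩
    (sperByCount k ⊙ count) n + (⟦ sper⁺Rhs k ⟧ n + ⟦ basePoly k ⊗ minusOne ⟧ n)
      ≡⟨ cong (_+_ ((sperByCount k ⊙ count) n)) (⟦⟧-++ (sper⁺Rhs k) (basePoly k ⊗ minusOne) n) ⟨
    (sperByCount k ⊙ count) n + ⟦ sperRhs k ⟧ n ∎

  areaGF-equation : ∀ n → (denom k ⊛ areaGF k) n ≡ numArea k n
  areaGF-equation n = begin
    (denom k ⊛ areaGF k) n
      ≡⟨ denom-⊛ k (areaGF k) n ⟩
    (basePoly k ⊙ (basePoly k ⊙ areaGF k)) n
      ≡⟨ ⊙-⊙-eliminate (basePoly k) (areaByCount k) (countRhs k) (areaRhs k) count (areaGF k)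
                        count-recurrence areaGF-recurrence n ⟩
    ⟦ areaByCount k ⊗ countRhs k ⟧ n + ⟦ basePoly k ⊗ areaRhs k ⟧ n
      ≡⟨ ⟦⟧-from-Φ (areaByCount k ⊗ countRhs k) (basePoly k ⊗ areaRhs k) (numAreaPoly k) (areaNumerator k) n ⟩
    ⟦ numAreaPoly k ⟧ n
      ≡⟨ numArea-⟦⟧ k n ⟨
    numArea k n ∎

  sperGF-equation : ∀ n → (denom k ⊛ sperGF k) n ≡ numSper k n
  sperGF-equation n = begin
    (denom k ⊛ sperGF k) n
      ≡⟨ denom-⊛ k (sperGF k) n ⟩
    (basePoly k ⊙ (basePoly k ⊙ sperGF k)) n
      ≡⟨ ⊙-⊙-eliminate (basePoly k) (sperByCount k) (countRhs k) (sperRhs k) count (sperGF k)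
                        count-recurrence sperGF-recurrence n ⟩
    ⟦ sperByCount k ⊗ countRhs k ⟧ n + ⟦ basePoly k ⊗ sperRhs k ⟧ n
      ≡⟨ ⟦⟧-from-Φ (sperByCount k ⊗ countRhs k) (basePoly k ⊗ sperRhs k) (numSperPoly k) (sperNumerator k) n ⟩
    ⟦ numSperPoly k ⟧ n
      ≡⟨ numSper-⟦⟧ k n ⟨
    numSper k n ∎

corollary1p2 : (k : ℕ) → k ≥ 2 →
    ((n : ℕ) → (denom k ⊛ areaGF k) n ≡ numArea k n) ×
    ((n : ℕ) → (denom k ⊛ sperGF k) n ≡ numSper k n)
corollary1p2 zero    ()
corollary1p2 (suc K) _ = Avoiding.areaGF-equation K , Avoiding.sperGF-equation K
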